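{- Let $G,H$ be finite digraphs and $L:V(G)\to 2^{V(H)}$ such that $G\times_L H^3$ admits a Maltsev list polymorphism. Let $(P(x,y))_{x,y\in V(G)}$ be the pair lists obtained after Preprocessing. If $x,y\in V(G)$ and $(a,c),(b,c),(b,d)\in P(x,y)$, then $(a,d)\in P(x,y)$.
   Context: A list polymorphism of arity $3$ on $G\times_L H^3$ is a map assigning to each $x\in V(G)$ and $a_1,a_2,a_3\in L(x)$ a vertex $h(x;a_1,a_2,a_3)\in L(x)$ such that whenever $xy\in A(G)$, $a_i\in L(x)$, $b_i\in L(y)$ and $a_ib_i\in A(H)$ for $i=1,2,3$, then $h(x;a_1,a_2,a_3)h(y;b_1,b_2,b_3)\in A(H)$; it is Maltsev if $h(x;a,a,a)=a$ and $h(x;a,b,b)=h(x;b,b,a)=a$ for all $x$ and $a,b\in L(x)$. Preprocessing ((2,3)-consistency): starting from $P(x,y)=L(x)\times L(y)$ for all ordered pairs $x,y\in V(G)$, one repeatedly deletes pairs until the following hold: (i) arc consistency: if $xy\in A(G)$ and $(a,b)\in P(x,y)$ then $ab\in A(H)$; (ii) pair consistency: if $(a,b)\in P(x,y)$ and $z\in V(G)$ then there is $c\in L(z)$ with $(a,c)\in P(x,z)$ and $(c,b)\in P(z,y)$. The resulting family is the largest family of pair lists $P(x,y)\subseteq L(x)\times L(y)$ satisfying (i) and (ii). -}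

module Defs where

open import Data.Nat using (ℕ)
open import Data.Fin using (Fin)
open import Data.Bool using (Bool; T)
open import Data.Product using (Σ; ∃; ∃-syntax; _×_)
open import Relation.Binary.PropositionalEquality using (_≡_)

Digraph : ℕ → Set
Digraph k = Fin k → Fin k → Bool

Lists : ℕ → ℕ → Set
Lists n m = Fin n → Fin m → Bool

-- Ternary list operation: h x a₁ a₂ a₃ (only its values on L(x)^3 matter).
Op3 : ℕ → ℕ → Set
Op3 n m = Fin n → Fin m → Fin m → Fin m → Fin m

module _ {n m : ℕ} (G : Digraph n) (H : Digraph m) (L : Lists n m) where

  IsListPolymorphism3 : Op3 n m → Set
  IsListPolymorphism3 h =
    (∀ x a₁ a₂ a₃ → T (L x a₁) → T (L x a₂) → T (L x a₃) → T (L x (h x a₁ a₂ a₃)))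
    × (∀ x y a₁ a₂ a₃ b₁ b₂ b₃ → T (G x y)
        → T (L x a₁) → T (L x a₂) → T (L x a₃)
        → T (L y b₁) → T (L y b₂) → T (L y b₃)
        → T (H a₁ b₁) → T (H a₂ b₂) → T (H a₃ b₃)
        → T (H (h x a₁ a₂ a₃) (h y b₁ b₂ b₃)))

  IsMaltsevListPolymorphism : Op3 n m → Set
  IsMaltsevListPolymorphism h =
    IsListPolymorphism3 h
    × (∀ x a → T (L x a) → h x a a a ≡ a)
    × (∀ x a b → T (L x a) → T (L x b) → h x a b b ≡ a)
    × (∀ x a b → T (L x a) → T (L x b) → h x b b a ≡ a)

  PairFamily : Set
  PairFamily = Fin n → Fin n → Fin m → Fin m → Bool

  IsConsistent : PairFamily → Set
  IsConsistent Q =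
    (∀ x y a b → T (Q x y a b) → T (L x a) × T (L y b))
    × (∀ x y a b → T (G x y) → T (Q x y a b) → T (H a b))
    × (∀ x y z a b → T (Q x y a b) →
         ∃[ c ] (T (L z c) × T (Q x z a c) × T (Q z y c b)))

  -- The result of Preprocessing: the largest consistent family, i.e.
  -- (a,b) ∈ P(x,y) iff (a,b) ∈ Q(x,y) for some consistent family Q.
  Preprocessed : Fin n → Fin n → Fin m → Fin m → Set
  Preprocessed x y a b = ∃[ Q ] (IsConsistent Q × T (Q x y a b))

{-# OPTIONS --safe #-}
-- Applying a list polymorphism h coordinatewise to three consistent pair
-- families yields a consistent family, so the largest one, P, is closed under h.
-- Applied to (a,c), (b,c), (b,d) ∈ P(x,y), the Maltsev identities turn
-- (h(a,b,b), h(c,c,d)) into (a,d).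
module Submission where

open import Defs
open import Data.Nat using (ℕ)
open import Data.Fin using (Fin; _≟_)
open import Data.Fin.Properties using (any?)
open import Data.Bool using (T)
open import Data.Bool.Properties using (T?)
open import Data.Product using (∃-syntax; _×_; _,_; proj₁; proj₂)
open import Relation.Nullary.Decidable using (Dec; ⌊_⌋; toWitness; fromWitness; _×-dec_)
open import Relation.Binary.PropositionalEquality using (_≡_; refl; subst₂)

module _ {n m : ℕ} {G : Digraph n} {H : Digraph m} {L : Lists n m} where

  module ListPolymorphism3 {h : Op3 n m} (poly : IsListPolymorphism3 G H L h) where

    preservesLists : ∀ {x a₁ a₂ a₃} → T (L x a₁) → T (L x a₂) → T (L x a₃) →
                     T (L x (h x a₁ a₂ a₃))
    preservesLists = proj₁ poly _ _ _ _

    preservesArcs : ∀ {x y a₁ a₂ a₃ b₁ b₂ b₃} → T (G x y) →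
                    T (L x a₁) × T (L y b₁) → T (L x a₂) × T (L y b₂) → T (L x a₃) × T (L y b₃) →
                    T (H a₁ b₁) → T (H a₂ b₂) → T (H a₃ b₃) →
                    T (H (h x a₁ a₂ a₃) (h y b₁ b₂ b₃))
    preservesArcs g (la₁ , lb₁) (la₂ , lb₂) (la₃ , lb₃) =
      proj₂ poly _ _ _ _ _ _ _ _ g la₁ la₂ la₃ lb₁ lb₂ lb₃

  module Consistent {Q : PairFamily G H L} (C : IsConsistent G H L Q) where

    inLists : ∀ {x y a b} → T (Q x y a b) → T (L x a) × T (L y b)
    inLists = proj₁ C _ _ _ _

    arcConsistent : ∀ {x y a b} → T (G x y) → T (Q x y a b) → T (H a b)
    arcConsistent = proj₁ (proj₂ C) _ _ _ _

    pairConsistent : ∀ {x y a b} z → T (Q x y a b) →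
                     ∃[ c ] (T (L z c) × T (Q x z a c) × T (Q z y c b))
    pairConsistent z = proj₂ (proj₂ C) _ _ z _ _

  module Image (h : Op3 n m) (Q₁ Q₂ Q₃ : PairFamily G H L) where

    InImage : Fin n → Fin n → Fin m → Fin m → Set
    InImage x y a b = ∃[ a₁ ] ∃[ a₂ ] ∃[ a₃ ] ∃[ b₁ ] ∃[ b₂ ] ∃[ b₃ ]
      (T (Q₁ x y a₁ b₁) × T (Q₂ x y a₂ b₂) × T (Q₃ x y a₃ b₃))
      × h x a₁ a₂ a₃ ≡ a × h y b₁ b₂ b₃ ≡ b

    inImage? : ∀ x y a b → Dec (InImage x y a b)
    inImage? x y a b =
      any? λ a₁ → any? λ a₂ → any? λ a₃ → any? λ b₁ → any? λ b₂ → any? λ b₃ →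
        (T? (Q₁ x y a₁ b₁) ×-dec T? (Q₂ x y a₂ b₂) ×-dec T? (Q₃ x y a₃ b₃))
        ×-dec h x a₁ a₂ a₃ ≟ a ×-dec h y b₁ b₂ b₃ ≟ b

    image : PairFamily G H L
    image x y a b = ⌊ inImage? x y a b ⌋

    image-intro : ∀ {x y a₁ a₂ a₃ b₁ b₂ b₃} →
                  T (Q₁ x y a₁ b₁) → T (Q₂ x y a₂ b₂) → T (Q₃ x y a₃ b₃) →
                  T (image x y (h x a₁ a₂ a₃) (h y b₁ b₂ b₃))
    image-intro q₁ q₂ q₃ = fromWitness (_ , _ , _ , _ , _ , _ , (q₁ , q₂ , q₃) , refl , refl)

    image-elim : ∀ {x y} (P : Fin m → Fin m → Set) →
                 (∀ {a₁ a₂ a₃ b₁ b₂ b₃} →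
                   T (Q₁ x y a₁ b₁) → T (Q₂ x y a₂ b₂) → T (Q₃ x y a₃ b₃) →
                   P (h x a₁ a₂ a₃) (h y b₁ b₂ b₃)) →
                 ∀ {a b} → T (image x y a b) → P a b
    image-elim P f t with toWitness t
    ... | _ , _ , _ , _ , _ , _ , (q₁ , q₂ , q₃) , refl , refl = f q₁ q₂ q₃

  module _ {h : Op3 n m} (poly : IsListPolymorphism3 G H L h)
           {Q₁ Q₂ Q₃ : PairFamily G H L}
           (C₁ : IsConsistent G H L Q₁) (C₂ : IsConsistent G H L Q₂)
           (C₃ : IsConsistent G H L Q₃) where

    open ListPolymorphism3 poly
    open Image h Q₁ Q₂ Q₃
    private
      module C₁ = Consistent C₁
      module C₂ = Consistent C₂
      module C₃ = Consistent C₃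

    image-inLists : ∀ x y a b → T (image x y a b) → T (L x a) × T (L y b)
    image-inLists x y _ _ = image-elim (λ a b → T (L x a) × T (L y b)) λ q₁ q₂ q₃ →
      let (la₁ , lb₁) = C₁.inLists q₁
          (la₂ , lb₂) = C₂.inLists q₂
          (la₃ , lb₃) = C₃.inLists q₃
      in preservesLists la₁ la₂ la₃ , preservesLists lb₁ lb₂ lb₃

    image-arcConsistent : ∀ x y a b → T (G x y) → T (image x y a b) → T (H a b)
    image-arcConsistent x y _ _ g = image-elim (λ a b → T (H a b)) λ q₁ q₂ q₃ →
      preservesArcs g (C₁.inLists q₁) (C₂.inLists q₂) (C₃.inLists q₃)
        (C₁.arcConsistent g q₁) (C₂.arcConsistent g q₂) (C₃.arcConsistent g q₃)

    image-pairConsistent : ∀ x y z a b → T (image x y a b) →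
                           ∃[ c ] (T (L z c) × T (image x z a c) × T (image z y c b))
    image-pairConsistent x y z _ _ =
      image-elim (λ a b → ∃[ c ] (T (L z c) × T (image x z a c) × T (image z y c b))) λ q₁ q₂ q₃ →
        let (c₁ , lc₁ , q₁ˡ , q₁ʳ) = C₁.pairConsistent z q₁
            (c₂ , lc₂ , q₂ˡ , q₂ʳ) = C₂.pairConsistent z q₂
            (c₃ , lc₃ , q₃ˡ , q₃ʳ) = C₃.pairConsistent z q₃
        in h z c₁ c₂ c₃ , preservesLists lc₁ lc₂ lc₃ ,
           image-intro q₁ˡ q₂ˡ q₃ˡ , image-intro q₁ʳ q₂ʳ q₃ʳ

    image-consistent : IsConsistent G H L image
    image-consistent = image-inLists , image-arcConsistent , image-pairConsistent

  Preprocessed-inLists : ∀ {x y a b} → Preprocessed G H L x y a b → T (L x a) × T (L y b)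
  Preprocessed-inLists (_ , C , q) = Consistent.inLists C q

  polymorphism-preserves-Preprocessed :
    ∀ {h} → IsListPolymorphism3 G H L h → ∀ {x y a₁ a₂ a₃ b₁ b₂ b₃} →
    Preprocessed G H L x y a₁ b₁ → Preprocessed G H L x y a₂ b₂ → Preprocessed G H L x y a₃ b₃ →
    Preprocessed G H L x y (h x a₁ a₂ a₃) (h y b₁ b₂ b₃)
  polymorphism-preserves-Preprocessed {h} poly (Q₁ , C₁ , q₁) (Q₂ , C₂ , q₂) (Q₃ , C₃ , q₃) =
    image , image-consistent poly C₁ C₂ C₃ , image-intro q₁ q₂ q₃
    where open Image h Q₁ Q₂ Q₃

corollary1 : {n m : ℕ} (G : Digraph n) (H : Digraph m) (L : Lists n m) →
    ∃[ h ] IsMaltsevListPolymorphism G H L h →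
    (x y : Fin n) (a b c d : Fin m) →
    Preprocessed G H L x y a c → Preprocessed G H L x y b c →
    Preprocessed G H L x y b d → Preprocessed G H L x y a d
corollary1 G H L (h , poly , _ , h[a,b,b]≡a , h[b,b,a]≡a) x y a b c d ac bc bd
  with (la , lc) ← Preprocessed-inLists ac
     | (lb , _) ← Preprocessed-inLists bc
     | (_ , ld) ← Preprocessed-inLists bd =
  subst₂ (Preprocessed G H L x y) (h[a,b,b]≡a x a b la lb) (h[b,b,a]≡a y d c ld lc)
    (polymorphism-preserves-Preprocessed poly ac bc bd)
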